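{- Let $\Sigma$ be a finite alphabet and $f:\Sigma^*\to\Sigma^*$ a function computed by a Turing machine $M$ in time $g:\mathbb{N}\to\mathbb{N}$. Then there is an encoding into $\Lambda_{\tt det}$ of $\Sigma$, of strings over $\Sigma$ (the Scott encoding $\ulcorner\cdot\urcorner_{\Sigma^*}$), and of Turing machines over $\Sigma$, giving a term $\ulcorner M\urcorner\in\Lambda_{\tt det}$, such that for every $s\in\Sigma^*$, $$\ulcorner M\urcorner\, \ulcorner s\urcorner_{\Sigma^*} \rightarrow_{det}^{n} \ulcorner f(s)\urcorner_{\Sigma^*}$$ with $n = \Theta(g(|s|)+|s|)$.
   Context: $\Lambda_{\tt det}$ (the deterministic $\lambda$-calculus): terms $t ::= v \mid t\,v$, values $v ::= \lambda x.t \mid x$; evaluation contexts $E ::= [\cdot] \mid E\,v$; reduction $E[(\lambda x.t)s] \rightarrow_{det} E[t\{x:=s\}]$; $\rightarrow_{det}^n$ means exactly $n$ steps. The constants in $\Theta$ may depend on $M$ (alphabet and state set are fixed). Scott encoding for $\Sigma=\{a_1,\dots,a_n\}$: $\ulcorner a_i\urcorner_\Sigma := \lambda x_1.\dots\lambda x_n.x_i$, $\ulcorner \varepsilon\urcorner_{\Sigma^*} := \lambda x_1.\dots\lambda x_n.\lambda y.y$, $\ulcorner a_i r\urcorner_{\Sigma^*} := \lambda x_1.\dots\lambda x_n.\lambda y.x_i\,\ulcorner r\urcorner_{\Sigma^*}$. A Turing machine $M=(\Sigma_\Box,Q,q_{in},q_{fin},\delta)$ has tape alphabet $\Sigma_\Box=\Sigma\cup\{\Box\}$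 ($\Box$ the blank), finite state set $Q$, initial and final states, and a partial transition function $\delta:Q\times\Sigma_\Box\rightharpoonup Q\times\Sigma_\Box\times\{\leftarrow,\rightarrow,\downarrow\}$ defined exactly when the state is not $q_{fin}$; configurations are quadruples (left tape, head symbol, right tape, state) evolving in the standard way (a head moving off the written tape reads $\Box$). $M$ computes $f$ in time $g$ if for every $s\in\Sigma^*$ the initial configuration $(\varepsilon,\Box,s,q_{in})$ evolves in $g(|s|)$ steps to the final configuration $(\varepsilon,\Box,f(s),q_{fin})$. -}

module Defs where

open import Data.Nat using (ℕ; zero; suc; _+_; _*_; _≤_)
open import Data.Fin using (Fin; zero; suc; opposite; _↑ˡ_)
open import Data.List using (List; []; _∷_; map)
open import Data.Maybe using (Maybe; just; nothing; _>>=_; Is-just)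
open import Data.Product using (_×_; _,_)
open import Relation.Binary.PropositionalEquality using (_≡_; _≢_)

mutual
  data Tm (n : ℕ) : Set where
    val : Val n → Tm n
    app : Tm n → Val n → Tm n

  data Val (n : ℕ) : Set where
    var : Fin n → Val n
    lam : Tm (suc n) → Val n

ext : ∀ {n m} → (Fin n → Fin m) → Fin (suc n) → Fin (suc m)
ext ρ zero    = zero
ext ρ (suc i) = suc (ρ i)

mutual
  renT : ∀ {n m} → (Fin n → Fin m) → Tm n → Tm m
  renT ρ (val v)   = val (renV ρ v)
  renT ρ (app t v) = app (renT ρ t) (renV ρ v)

  renV : ∀ {n m} → (Fin n → Fin m) → Val n → Val m
  renV ρ (var i) = var (ρ i)
  renV ρ (lam t) = lam (renT (ext ρ) t)

exts : ∀ {n m} → (Fin n → Val m) → Fin (suc n) → Val (suc m)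
exts σ zero    = var zero
exts σ (suc i) = renV suc (σ i)

mutual
  subT : ∀ {n m} → (Fin n → Val m) → Tm n → Tm m
  subT σ (val v)   = val (subV σ v)
  subT σ (app t v) = app (subT σ t) (subV σ v)

  subV : ∀ {n m} → (Fin n → Val m) → Val n → Val m
  subV σ (var i) = σ i
  subV σ (lam t) = lam (subT (exts σ) t)

_[_] : ∀ {n} → Tm (suc n) → Val n → Tm n
t [ s ] = subT σ t
  where
    σ : Fin (suc _) → Val _
    σ zero    = s
    σ (suc i) = var i

-- Deterministic reduction  E[(λx.t)s] →det E[t{x:=s}],  E ::= [·] | E v
infix 4 _⟶_
data _⟶_ {n : ℕ} : Tm n → Tm n → Set where
  β   : ∀ {t : Tm (suc n)} {s : Val n} → app (val (lam t)) s ⟶ t [ s ]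
  ctx : ∀ {t t' : Tm n} {v : Val n} → t ⟶ t' → app t v ⟶ app t' v

data Steps {n : ℕ} : ℕ → Tm n → Tm n → Set where
  done : ∀ {t} → Steps zero t t
  step : ∀ {k t u w} → t ⟶ u → Steps k u w → Steps (suc k) t w

lams : ∀ {n} (j : ℕ) → Tm (suc j + n) → Val n
lams zero    t = lam t
lams (suc j) t = lams j (val (lam t))

-- ⌜a_i⌝ = λx_1…λx_k. x_i   (only letters exist when k ≥ 1)
encSym : ∀ {k n} → Fin k → Val n
encSym {suc k} {n} a = lams k (val (var (opposite a ↑ˡ n)))

-- ⌜ε⌝ = λx_1…λx_k.λy.y ;  ⌜a_i r⌝ = λx_1…λx_k.λy. x_i ⌜r⌝
encStr : ∀ {k n} → List (Fin k) → Val n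
encStr {k} {n} []      = lams k (val (var zero))
encStr {k} {n} (a ∷ r) = lams k (app (val (var (suc (opposite a) ↑ˡ n))) (encStr r))

-- Turing machines over Σ = Fin k, Σ_□ = Maybe (Fin k) (nothing = □)

Sym□ : ℕ → Set
Sym□ k = Maybe (Fin k)

data Dir : Set where
  left right stay : Dir

record TM (k : ℕ) : Set where
  field
    states : ℕ
    q-in q-fin : Fin states
    δ     : Fin states → Sym□ k → Maybe (Fin states × Sym□ k × Dir)
    δ-fin : ∀ a → δ q-fin a ≡ nothing
    δ-def : ∀ q a → q ≢ q-fin → Is-just (δ q a)

-- configuration (left tape, head symbol, right tape, state);
-- the left tape is stored reversed (its head is the cell next to the head)
record Config (k Q : ℕ) : Set where
  constructor conf
  field
    ltape : List (Sym□ k)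
    hd    : Sym□ k
    rtape : List (Sym□ k)
    state : Fin Q

move : ∀ {k Q} → List (Sym□ k) → Sym□ k → List (Sym□ k) → Fin Q → Dir → Config k Q
move l b r q stay        = conf l b r q
move l b []      q right = conf (b ∷ l) nothing [] q
move l b (c ∷ r) q right = conf (b ∷ l) c r q
move []      b r q left  = conf [] nothing (b ∷ r) q
move (c ∷ l) b r q left  = conf l c (b ∷ r) q

stepTM : ∀ {k} (M : TM k) → Config k (TM.states M) → Maybe (Config k (TM.states M))
stepTM M (conf l a r q) with TM.δ M q a
... | nothing            = nothing
... | just (q' , b , d)  = just (move l b r q' d)

runTM : ∀ {k} (M : TM k) → ℕ → Config k (TM.states M) → Maybe (Config k (TM.states M))
runTM M zero    c = just c
runTM M (suc n) c = stepTM M c >>= runTM M n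

Computes : ∀ {k} → TM k → (List (Fin k) → List (Fin k)) → (ℕ → ℕ) → Set
Computes {k} M f g = ∀ (s : List (Fin k)) →
  runTM M (g (Data.List.length s)) (conf [] nothing (map just s) (TM.q-in M))
    ≡ just (conf [] nothing (map just (f s)) (TM.q-fin M))

-- A configuration (l, a, r, q) of M is represented by the term T ⌜q⌝ T ⌜l⌝ ⌜a⌝ ⌜r⌝: states and tape symbols
-- are selectors λx_j…λx_0. x_i, tapes are Scott-encoded lists, and T applies ⌜q⌝ to a table of closures, one per
-- state, which read the head symbol, select the transition and rebuild the next configuration. One machine step
-- thus costs between 1 and 15 + |Σ| + |Q| β-steps, independently of the tape. Before the simulation a reader
-- turns ⌜s⌝ into the initial configuration in Θ(|s|) steps, and the final state converts its tape back into
-- ⌜f(s)⌝ in O(|f(s)|) steps. Since the tape grows by at most one cell per step, |f(s)| ≤ |s| + g(|s|), so the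
-- total number of steps lies between g(|s|) + |s| and a constant multiple of it. All recursion (T, the reader,
-- the converter) is by self-application.

module Submission where

open import Defs
open import Data.Nat using (ℕ; zero; suc; _+_; _*_; _≤_; z≤n; s≤s)
open import Data.Nat.Properties
  using ( ≤-refl; ≤-trans; ≤-reflexive; n≤1+n; m≤m+n; m≤n+m; m≤m*n; +-suc; +-comm; +-identityʳ; *-identityˡ
        ; +-mono-≤; +-monoʳ-≤; +-monoˡ-≤; *-monoʳ-≤; *-monoˡ-≤; module ≤-Reasoning)
open import Data.Nat.Tactic.RingSolver using (solve-∀)
open import Data.Fin using (Fin; zero; suc; opposite; _↑ˡ_; _↑ʳ_; _≟_)
open import Data.Fin.Properties using (opposite-involutive)
open import Data.List using (List; []; _∷_; map; length; _ʳ++_)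
open import Data.List.Properties using (length-map; reverse-involutive)
open import Data.Maybe using (Maybe; just; nothing)
open import Data.Product using (Σ; _×_; _,_)
open import Relation.Binary.PropositionalEquality
open import Relation.Nullary using (Dec; yes; no; contradiction)

-- Renaming and substitution

ext-∘ : ∀ {n m p} {ρ : Fin m → Fin p} {ρ′ : Fin n → Fin m} {ρ″ : Fin n → Fin p} →
        (∀ i → ρ (ρ′ i) ≡ ρ″ i) → ∀ i → ext ρ (ext ρ′ i) ≡ ext ρ″ i
ext-∘ h zero    = refl
ext-∘ h (suc i) = cong suc (h i)

exts-ext : ∀ {n m p} {σ : Fin m → Val p} {ρ : Fin n → Fin m} {τ : Fin n → Val p} →
           (∀ i → σ (ρ i) ≡ τ i) → ∀ i → exts σ (ext ρ i) ≡ exts τ i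
exts-ext h zero    = refl
exts-ext h (suc i) = cong (renV suc) (h i)

ext-id : ∀ {n} {ρ : Fin n → Fin n} → (∀ i → ρ i ≡ i) → ∀ i → ext ρ i ≡ i
ext-id h zero    = refl
ext-id h (suc i) = cong suc (h i)

exts-id : ∀ {n} {σ : Fin n → Val n} → (∀ i → σ i ≡ var i) → ∀ i → exts σ i ≡ var i
exts-id h zero    = refl
exts-id h (suc i) = cong (renV suc) (h i)

mutual
  renT-∘ : ∀ {n m p} {ρ : Fin m → Fin p} {ρ′ : Fin n → Fin m} {ρ″ : Fin n → Fin p} →
           (∀ i → ρ (ρ′ i) ≡ ρ″ i) → ∀ t → renT ρ (renT ρ′ t) ≡ renT ρ″ t
  renT-∘ h (val v)   = cong val (renV-∘ h v)
  renT-∘ h (app t v) = cong₂ app (renT-∘ h t) (renV-∘ h v)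

  renV-∘ : ∀ {n m p} {ρ : Fin m → Fin p} {ρ′ : Fin n → Fin m} {ρ″ : Fin n → Fin p} →
           (∀ i → ρ (ρ′ i) ≡ ρ″ i) → ∀ v → renV ρ (renV ρ′ v) ≡ renV ρ″ v
  renV-∘ h (var i) = cong var (h i)
  renV-∘ h (lam t) = cong lam (renT-∘ (ext-∘ h) t)

mutual
  renT-id : ∀ {n} {ρ : Fin n → Fin n} → (∀ i → ρ i ≡ i) → ∀ t → renT ρ t ≡ t
  renT-id h (val v)   = cong val (renV-id h v)
  renT-id h (app t v) = cong₂ app (renT-id h t) (renV-id h v)

  renV-id : ∀ {n} {ρ : Fin n → Fin n} → (∀ i → ρ i ≡ i) → ∀ v → renV ρ v ≡ v
  renV-id h (var i) = cong var (h i)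
  renV-id h (lam t) = cong lam (renT-id (ext-id h) t)

mutual
  subT-renT : ∀ {n m p} {σ : Fin m → Val p} {ρ : Fin n → Fin m} {τ : Fin n → Val p} →
              (∀ i → σ (ρ i) ≡ τ i) → ∀ t → subT σ (renT ρ t) ≡ subT τ t
  subT-renT h (val v)   = cong val (subV-renV h v)
  subT-renT h (app t v) = cong₂ app (subT-renT h t) (subV-renV h v)

  subV-renV : ∀ {n m p} {σ : Fin m → Val p} {ρ : Fin n → Fin m} {τ : Fin n → Val p} →
              (∀ i → σ (ρ i) ≡ τ i) → ∀ v → subV σ (renV ρ v) ≡ subV τ v
  subV-renV h (var i) = h i
  subV-renV h (lam t) = cong lam (subT-renT (exts-ext h) t)

ext-exts : ∀ {n m p} {ρ : Fin m → Fin p} {σ : Fin n → Val m} {τ : Fin n → Val p} →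
           (∀ i → renV ρ (σ i) ≡ τ i) → ∀ i → renV (ext ρ) (exts σ i) ≡ exts τ i
ext-exts h zero    = refl
ext-exts {σ = σ} h (suc i) =
  trans (renV-∘ (λ _ → refl) (σ i)) (trans (sym (renV-∘ (λ _ → refl) (σ i))) (cong (renV suc) (h i)))

mutual
  renT-subT : ∀ {n m p} {ρ : Fin m → Fin p} {σ : Fin n → Val m} {τ : Fin n → Val p} →
              (∀ i → renV ρ (σ i) ≡ τ i) → ∀ t → renT ρ (subT σ t) ≡ subT τ t
  renT-subT h (val v)   = cong val (renV-subV h v)
  renT-subT h (app t v) = cong₂ app (renT-subT h t) (renV-subV h v)

  renV-subV : ∀ {n m p} {ρ : Fin m → Fin p} {σ : Fin n → Val m} {τ : Fin n → Val p} →
              (∀ i → renV ρ (σ i) ≡ τ i) → ∀ v → renV ρ (subV σ v) ≡ subV τ v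
  renV-subV h (var i) = h i
  renV-subV h (lam t) = cong lam (renT-subT (ext-exts h) t)

exts-exts : ∀ {n m p} {σ : Fin m → Val p} {σ′ : Fin n → Val m} {τ : Fin n → Val p} →
            (∀ i → subV σ (σ′ i) ≡ τ i) → ∀ i → subV (exts σ) (exts σ′ i) ≡ exts τ i
exts-exts h zero    = refl
exts-exts {σ′ = σ′} h (suc i) =
  trans (subV-renV (λ _ → refl) (σ′ i)) (trans (sym (renV-subV (λ _ → refl) (σ′ i))) (cong (renV suc) (h i)))

mutual
  subT-∘ : ∀ {n m p} {σ : Fin m → Val p} {σ′ : Fin n → Val m} {τ : Fin n → Val p} →
           (∀ i → subV σ (σ′ i) ≡ τ i) → ∀ t → subT σ (subT σ′ t) ≡ subT τ t
  subT-∘ h (val v)   = cong val (subV-∘ h v)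
  subT-∘ h (app t v) = cong₂ app (subT-∘ h t) (subV-∘ h v)

  subV-∘ : ∀ {n m p} {σ : Fin m → Val p} {σ′ : Fin n → Val m} {τ : Fin n → Val p} →
           (∀ i → subV σ (σ′ i) ≡ τ i) → ∀ v → subV σ (subV σ′ v) ≡ subV τ v
  subV-∘ h (var i) = h i
  subV-∘ h (lam t) = cong lam (subT-∘ (exts-exts h) t)

mutual
  subT-id : ∀ {n} {σ : Fin n → Val n} → (∀ i → σ i ≡ var i) → ∀ t → subT σ t ≡ t
  subT-id h (val v)   = cong val (subV-id h v)
  subT-id h (app t v) = cong₂ app (subT-id h t) (subV-id h v)

  subV-id : ∀ {n} {σ : Fin n → Val n} → (∀ i → σ i ≡ var i) → ∀ v → subV σ v ≡ v
  subV-id h (var i) = h i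
  subV-id h (lam t) = cong lam (subT-id (exts-id h) t)

-- Closures and reduction sequences

ƛ_ : ∀ {n} → Tm (suc n) → Tm n
ƛ t = val (lam t)

ix : ∀ {n} (i : ℕ) → Fin (suc i + n)
ix zero    = zero
ix (suc i) = suc (ix i)

#ᵛ_ : ∀ {n} (i : ℕ) → Val (suc i + n)
#ᵛ i = var (ix i)

#_ : ∀ {n} (i : ℕ) → Tm (suc i + n)
# i = val (#ᵛ i)

apps : ∀ {n} → Tm n → List (Val n) → Tm n
apps t []       = t
apps t (v ∷ vs) = apps (app t v) vs

-- appsFin t j h = t (h j) ⋯ (h 0), so that h i is bound to the de Bruijn index i under j + 1 binders
appsFin : ∀ {n} → Tm n → (j : ℕ) → (Fin (suc j) → Val n) → Tm n
appsFin t zero    h = app t (h zero)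
appsFin t (suc j) h = app (appsFin t j (λ i → h (suc i))) (h zero)

Env : ℕ → Set
Env m = Fin m → Val 0

∅ₑ : Env 0
∅ₑ ()

infixr 5 _∷ₑ_
_∷ₑ_ : ∀ {m} → Val 0 → Env m → Env (suc m)
(w ∷ₑ E) zero    = w
(w ∷ₑ E) (suc i) = E i

-- closure E t is the closed value λ.t in which the free variables 1, …, m of t are bound to E
closure : ∀ {m} → Env m → Tm (suc m) → Val 0
closure E t = lam (subT (exts E) t)

β-closure : ∀ {m} (E : Env m) (t : Tm (suc m)) (w : Val 0) →
            app (val (closure E t)) w ⟶ subT (w ∷ₑ E) t
β-closure E t w = subst (app (val (closure E t)) w ⟶_) (subT-∘ (instantiate refl) t) β
  where
    instantiate : ∀ {σ : Fin 1 → Val 0} → σ zero ≡ w → ∀ i → subV σ (exts E i) ≡ (w ∷ₑ E) i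
    instantiate σ₀ zero    = σ₀
    instantiate σ₀ (suc i) = trans (subV-renV {τ = var} (λ ()) (E i)) (subV-id (λ ()) (E i))

module _ {n : ℕ} where

  infixr 5 _++ₛ_
  _++ₛ_ : ∀ {a b} {t u w : Tm n} → Steps a t u → Steps b u w → Steps (a + b) t w
  done     ++ₛ q = q
  step x p ++ₛ q = step x (p ++ₛ q)

  step₁ : ∀ {t u : Tm n} → t ⟶ u → Steps 1 t u
  step₁ x = step x done

  _∷ʳₛ_ : ∀ {a} {t u w : Tm n} → Steps a t u → u ⟶ w → Steps (suc a) t w
  done     ∷ʳₛ x = step₁ x
  step y p ∷ʳₛ x = step y (p ∷ʳₛ x)

  Steps-≡ : ∀ {a} {t t′ u u′ : Tm n} → t ≡ t′ → u ≡ u′ → Steps a t u → Steps a t′ u′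
  Steps-≡ refl refl p = p

  -- opaque, so that Agda never normalises the arithmetic proofs that Steps-count is applied to
  opaque
    Steps-count : ∀ {a b} {t u : Tm n} → a ≡ b → Steps a t u → Steps b t u
    Steps-count refl p = p

  Steps-app : ∀ {a} {t t′ : Tm n} {v : Val n} → Steps a t t′ → Steps a (app t v) (app t′ v)
  Steps-app done       = done
  Steps-app (step x p) = step (ctx x) (Steps-app p)

  Steps-apps : ∀ {a} {t t′ : Tm n} (vs : List (Val n)) → Steps a t t′ → Steps a (apps t vs) (apps t′ vs)
  Steps-apps []       p = p
  Steps-apps (v ∷ vs) p = Steps-apps vs (Steps-app p)

  StepsWithin : ℕ → ℕ → Tm n → Tm n → Set
  StepsWithin lo hi t u = Σ ℕ λ a → Steps a t u × lo ≤ a × a ≤ hi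

  exactly : ∀ {a} {t u : Tm n} → Steps a t u → StepsWithin a a t u
  exactly p = _ , p , ≤-refl , ≤-refl

  infixr 5 _++ʷ_
  _++ʷ_ : ∀ {lo hi lo′ hi′} {t u w : Tm n} →
          StepsWithin lo hi t u → StepsWithin lo′ hi′ u w → StepsWithin (lo + lo′) (hi + hi′) t w
  (a , p , l , h) ++ʷ (b , q , l′ , h′) = a + b , p ++ₛ q , +-mono-≤ l l′ , +-mono-≤ h h′

  StepsWithin-weaken : ∀ {lo hi lo′ hi′} {t u : Tm n} →
                       lo′ ≤ lo → hi ≤ hi′ → StepsWithin lo hi t u → StepsWithin lo′ hi′ t u
  StepsWithin-weaken l≤ ≤h (a , p , l , h) = a , p , ≤-trans l≤ l , ≤-trans h ≤h

β-closure₁ : ∀ {m} (E : Env m) t w₁ vs →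
             Steps 1 (apps (val (closure E t)) (w₁ ∷ vs)) (apps (subT (w₁ ∷ₑ E) t) vs)
β-closure₁ E t w₁ vs = Steps-apps vs (step₁ (β-closure E t w₁))

β-closure₂ : ∀ {m} (E : Env m) t w₁ w₂ vs →
             Steps 2 (apps (val (closure E (ƛ t))) (w₁ ∷ w₂ ∷ vs)) (apps (subT (w₂ ∷ₑ w₁ ∷ₑ E) t) vs)
β-closure₂ E t w₁ w₂ vs = β-closure₁ E (ƛ t) w₁ (w₂ ∷ vs) ++ₛ β-closure₁ (w₁ ∷ₑ E) t w₂ vs

β-closure₃ : ∀ {m} (E : Env m) t w₁ w₂ w₃ vs →
             Steps 3 (apps (val (closure E (ƛ ƛ t))) (w₁ ∷ w₂ ∷ w₃ ∷ vs))
                     (apps (subT (w₃ ∷ₑ w₂ ∷ₑ w₁ ∷ₑ E) t) vs)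
β-closure₃ E t w₁ w₂ w₃ vs =
  β-closure₁ E (ƛ ƛ t) w₁ (w₂ ∷ w₃ ∷ vs) ++ₛ β-closure₂ (w₁ ∷ₑ E) t w₂ w₃ vs

β-closure₄ : ∀ {m} (E : Env m) t w₁ w₂ w₃ w₄ vs →
             Steps 4 (apps (val (closure E (ƛ ƛ ƛ t))) (w₁ ∷ w₂ ∷ w₃ ∷ w₄ ∷ vs))
                     (apps (subT (w₄ ∷ₑ w₃ ∷ₑ w₂ ∷ₑ w₁ ∷ₑ E) t) vs)
β-closure₄ E t w₁ w₂ w₃ w₄ vs =
  β-closure₁ E (ƛ ƛ ƛ t) w₁ (w₂ ∷ w₃ ∷ w₄ ∷ vs) ++ₛ β-closure₃ (w₁ ∷ₑ E) t w₂ w₃ w₄ vs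

-- Selectors and Scott-encoded strings

subT-appsFin : ∀ {n m} (σ : Fin n → Val m) t j h →
               subT σ (appsFin t j h) ≡ appsFin (subT σ t) j (λ i → subV σ (h i))
subT-appsFin σ t zero    h = refl
subT-appsFin σ t (suc j) h = cong (λ u → app u (subV σ (h zero))) (subT-appsFin σ t j (λ i → h (suc i)))

envFin : ∀ {m} (j : ℕ) → (Fin (suc j) → Val 0) → Env m → Env (suc j + m)
envFin zero    h E = h zero ∷ₑ E
envFin (suc j) h E = h zero ∷ₑ envFin j (λ i → h (suc i)) E

envFin-↑ˡ : ∀ {m} j h (E : Env m) (i : Fin (suc j)) → envFin j h E (i ↑ˡ m) ≡ h i
envFin-↑ˡ zero    h E zero    = refl
envFin-↑ˡ (suc j) h E zero    = refl
envFin-↑ˡ (suc j) h E (suc i) = envFin-↑ˡ j (λ i → h (suc i)) E i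

lams-appsFin : ∀ {m} j (E : Env m) (t : Tm (suc j + m)) h →
               Steps (suc j) (appsFin (val (subV E (lams j t))) j h) (subT (envFin j h E) t)
lams-appsFin zero    E t h = step₁ (β-closure E t (h zero))
lams-appsFin (suc j) E t h = Steps-app (lams-appsFin j E (val (lam t)) (λ i → h (suc i)))
                             ∷ʳₛ β-closure (envFin j (λ i → h (suc i)) E) t (h zero)

select : (j : ℕ) → Fin (suc j) → Val 0
select j i = lams j (val (var (i ↑ˡ 0)))

select-appsFin : ∀ j i h → Steps (suc j) (appsFin (val (select j i)) j h) (val (h i))
select-appsFin j i h = Steps-≡ (cong (λ v → appsFin (val v) j h) (subV-id (λ ()) (select j i)))
                               (cong val (envFin-↑ˡ j h ∅ₑ i))
                               (lams-appsFin j ∅ₑ (val (var (i ↑ˡ 0))) h)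

extsⁿ : ∀ {n m} (j : ℕ) → (Fin n → Val m) → Fin (j + n) → Val (j + m)
extsⁿ zero    σ = σ
extsⁿ (suc j) σ = exts (extsⁿ j σ)

extⁿ : ∀ {n m} (j : ℕ) → (Fin n → Fin m) → Fin (j + n) → Fin (j + m)
extⁿ zero    ρ = ρ
extⁿ (suc j) ρ = ext (extⁿ j ρ)

subV-lams : ∀ {n m} j (σ : Fin n → Val m) t → subV σ (lams j t) ≡ lams j (subT (extsⁿ (suc j) σ) t)
subV-lams zero    σ t = refl
subV-lams (suc j) σ t = subV-lams j σ (val (lam t))

renV-lams : ∀ {n m} j (ρ : Fin n → Fin m) t → renV ρ (lams j t) ≡ lams j (renT (extⁿ (suc j) ρ) t)
renV-lams zero    ρ t = refl
renV-lams (suc j) ρ t = renV-lams j ρ (val (lam t))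

extsⁿ-↑ˡ : ∀ {n m} j (σ : Fin n → Val m) (i : Fin j) → extsⁿ j σ (i ↑ˡ n) ≡ var (i ↑ˡ m)
extsⁿ-↑ˡ (suc j) σ zero    = refl
extsⁿ-↑ˡ (suc j) σ (suc i) = cong (renV suc) (extsⁿ-↑ˡ j σ i)

extⁿ-↑ˡ : ∀ {n m} j (ρ : Fin n → Fin m) (i : Fin j) → extⁿ j ρ (i ↑ˡ n) ≡ i ↑ˡ m
extⁿ-↑ˡ (suc j) ρ zero    = refl
extⁿ-↑ˡ (suc j) ρ (suc i) = cong suc (extⁿ-↑ˡ j ρ i)

extsⁿ-↑ʳ : ∀ {n m} j (σ : Fin n → Val m) (i : Fin n) → extsⁿ j σ (j ↑ʳ i) ≡ renV (j ↑ʳ_) (σ i)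
extsⁿ-↑ʳ zero    σ i = sym (renV-id (λ _ → refl) (σ i))
extsⁿ-↑ʳ (suc j) σ i = trans (cong (renV suc) (extsⁿ-↑ʳ j σ i)) (renV-∘ (λ _ → refl) (σ i))

renV-encStr : ∀ {k n m} (ρ : Fin n → Fin m) (r : List (Fin k)) → renV ρ (encStr {k} {n} r) ≡ encStr r
renV-encStr {k} ρ []      = renV-lams k ρ (val (var zero))
renV-encStr {k} ρ (a ∷ r) =
  trans (renV-lams k ρ _)
        (cong₂ (λ x v → lams k (app (val (var x)) v)) (extⁿ-↑ˡ (suc k) ρ (suc (opposite a))) (renV-encStr _ r))

subV-encStr : ∀ {k n m} (σ : Fin n → Val m) (r : List (Fin k)) → subV σ (encStr {k} {n} r) ≡ encStr r
subV-encStr {k} σ []      = subV-lams k σ (val (var zero))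
subV-encStr {k} σ (a ∷ r) =
  trans (subV-lams k σ _)
        (cong₂ (λ x v → lams k (app (val x) v)) (extsⁿ-↑ˡ (suc k) σ (suc (opposite a))) (subV-encStr _ r))

encStr-[]-appsFin : ∀ {k} h → Steps (suc k) (appsFin (val (encStr {k} [])) k h) (val (h zero))
encStr-[]-appsFin {k} h =
  Steps-≡ (cong (λ v → appsFin (val v) k h) (subV-id (λ ()) (encStr {k} [])))
          (cong val (envFin-↑ˡ k h ∅ₑ zero))
          (lams-appsFin k ∅ₑ _ h)

encStr-∷-appsFin : ∀ {k} (a : Fin k) r h →
                   Steps (suc k) (appsFin (val (encStr (a ∷ r))) k h) (app (val (h (suc (opposite a)))) (encStr r))
encStr-∷-appsFin {k} a r h =
  Steps-≡ (cong (λ v → appsFin (val v) k h) (subV-id (λ ()) (encStr (a ∷ r))))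
          (cong₂ (λ v w → app (val v) w) (envFin-↑ˡ k h ∅ₑ (suc (opposite a))) (subV-encStr _ r))
          (lams-appsFin k ∅ₑ _ h)

-- tapes are Scott-encoded lists: [] = λn.λc. n  and  b ∷ l = λn.λc. c b l
nilᵛ : ∀ {n} → Val n
nilᵛ = lam (ƛ # 1)

consᵛ : Val 0 → Val 0 → Val 0
consᵛ b l = closure (b ∷ₑ l ∷ₑ ∅ₑ) (ƛ apps (# 0) (#ᵛ 2 ∷ #ᵛ 3 ∷ []))

nilᵛ-case : ∀ (n c w : Val 0) → Steps 2 (apps (val nilᵛ) (n ∷ c ∷ w ∷ [])) (app (val n) w)
nilᵛ-case n c w = β-closure₂ ∅ₑ (# 1) n c (w ∷ [])

consᵛ-case : ∀ (b l n c w : Val 0) →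
             Steps 2 (apps (val (consᵛ b l)) (n ∷ c ∷ w ∷ [])) (apps (val c) (b ∷ l ∷ w ∷ []))
consᵛ-case b l n c w = β-closure₂ (b ∷ₑ l ∷ₑ ∅ₑ) (apps (# 0) (#ᵛ 2 ∷ #ᵛ 3 ∷ [])) n c (w ∷ [])

-- Tape growth of Turing machines

tapeLength : ∀ {k Q} → Config k Q → ℕ
tapeLength (conf l a r q) = length l + length r

tapeLength-move : ∀ {k Q} l b r (q : Fin Q) d → tapeLength {k} (move l b r q d) ≤ suc (length l + length r)
tapeLength-move l b r       q stay  = n≤1+n _
tapeLength-move l b []      q right = ≤-refl
tapeLength-move l b (c ∷ r) q right = s≤s (+-monoʳ-≤ (length l) (n≤1+n (length r)))
tapeLength-move []      b r q left  = ≤-refl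
tapeLength-move (c ∷ l) b r q left  = ≤-trans (≤-reflexive (+-suc (length l) (length r))) (n≤1+n _)

module _ {k} (M : TM k) where

  stepTM-tapeLength : ∀ c c′ → stepTM M c ≡ just c′ → tapeLength c′ ≤ suc (tapeLength c)
  stepTM-tapeLength (conf l a r q) c′ eq with TM.δ M q a
  ... | just (q′ , b , d) with refl ← eq = tapeLength-move l b r q′ d

  runTM-suc : ∀ t c c′ → runTM M (suc t) c ≡ just c′ →
              Σ (Config k (TM.states M)) λ c₁ → stepTM M c ≡ just c₁ × runTM M t c₁ ≡ just c′
  runTM-suc t c c′ eq with stepTM M c
  ... | just c₁ = c₁ , refl , eq

  runTM-tapeLength : ∀ t c c′ → runTM M t c ≡ just c′ → tapeLength c′ ≤ tapeLength c + t
  runTM-tapeLength zero    c .c refl = ≤-reflexive (sym (+-identityʳ _))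
  runTM-tapeLength (suc t) c c′ eq with runTM-suc t c c′ eq
  ... | c₁ , stepped , ran = begin
    tapeLength c′             ≤⟨ runTM-tapeLength t c₁ c′ ran ⟩
    tapeLength c₁ + t         ≤⟨ +-monoˡ-≤ t (stepTM-tapeLength c c₁ stepped) ⟩
    suc (tapeLength c) + t    ≡⟨ sym (+-suc (tapeLength c) t) ⟩
    tapeLength c + suc t      ∎
    where open ≤-Reasoning

linear-sandwich : ∀ B {S G F n} → 1 ≤ B → F ≤ S + G →
                  S + (G + 0) ≤ n → n ≤ (S * B + B) + (G * B + (F * B + B)) →
                  n ≤ 2 * B * (G + S) + 2 * B × G + S ≤ 2 * B * n
linear-sandwich B {S} {G} {F} {n} 1≤B F≤S+G lower upper = n≤ , ≤n
  where
    open ≤-Reasoning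
    collect : ∀ S G B → (S * B + B) + (G * B + ((S + G) * B + B)) ≡ 2 * B * (G + S) + 2 * B
    collect = solve-∀
    F*B+B≤ : F * B + B ≤ (S + G) * B + B
    F*B+B≤ = +-monoˡ-≤ B (*-monoˡ-≤ B F≤S+G)
    n≤ : n ≤ 2 * B * (G + S) + 2 * B
    n≤ = begin
      n                                           ≤⟨ upper ⟩
      (S * B + B) + (G * B + (F * B + B))         ≤⟨ +-monoʳ-≤ (S * B + B) (+-monoʳ-≤ (G * B) F*B+B≤) ⟩
      (S * B + B) + (G * B + ((S + G) * B + B))   ≡⟨ collect S G B ⟩
      2 * B * (G + S) + 2 * B                     ∎
    ≤n : G + S ≤ 2 * B * n
    ≤n = begin
      G + S        ≡⟨ trans (+-comm G S) (cong (S +_) (sym (+-identityʳ G))) ⟩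
      S + (G + 0)  ≤⟨ lower ⟩
      n            ≡⟨ sym (*-identityˡ n) ⟩
      1 * n        ≤⟨ *-monoˡ-≤ n (≤-trans 1≤B (m≤m+n B (B + 0))) ⟩
      2 * B * n    ∎

-- Compiling a Turing machine

module Simulation {k : ℕ} (M : TM k) where
  open TM M

  symIx : Sym□ k → Fin (suc k)
  symIx nothing  = zero
  symIx (just a) = suc a

  ixSym : Fin (suc k) → Sym□ k
  ixSym zero    = nothing
  ixSym (suc a) = just a

  symᵛ : Sym□ k → Val 0
  symᵛ a = select k (symIx a)

  -- index 0 is a dummy: a selector needs at least one argument
  stateᵛ : Fin states → Val 0
  stateᵛ q = select states (suc q)

  tapeᵛ : List (Sym□ k) → Val 0
  tapeᵛ []      = nilᵛ
  tapeᵛ (b ∷ l) = consᵛ (symᵛ b) (tapeᵛ l)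

  -- ⌜a x⌝ with x the variable 1
  encCons : Fin k → Val 2
  encCons a = lams k (app (val (var (suc (opposite a) ↑ˡ 2))) (var (suc k ↑ʳ suc zero)))

  subV-encCons : ∀ (κ : Val 0) a (r : List (Fin k)) →
                 subV (κ ∷ₑ encStr r ∷ₑ ∅ₑ) (encCons a) ≡ encStr (a ∷ r)
  subV-encCons κ a r =
    trans (subV-lams k σ _)
          (cong₂ (λ x v → lams k (app (val x) v)) (extsⁿ-↑ˡ (suc k) σ (suc (opposite a)))
                 (trans (extsⁿ-↑ʳ (suc k) σ (suc zero)) (renV-encStr _ r)))
    where
      σ : Env 2
      σ = κ ∷ₑ encStr r ∷ₑ ∅ₑ

  -- push a = λx.λκ. κ ⌜a x⌝
  pushᵛ : Fin k → Val 0
  pushᵛ a = closure ∅ₑ (ƛ app (# 0) (encCons a))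

  push-steps : ∀ a r κ → Steps 2 (apps (val (pushᵛ a)) (encStr r ∷ κ ∷ [])) (app (val κ) (encStr (a ∷ r)))
  push-steps a r κ = Steps-≡ refl (cong (app (val κ)) (subV-encCons κ a r))
                             (β-closure₂ ∅ₑ (app (# 0) (encCons a)) (encStr r) κ [])

  -- the entry for □ is never used, as the output tape contains no blanks
  pushTable : Fin (suc k) → Val 0
  pushTable zero    = nilᵛ
  pushTable (suc a) = pushᵛ a

  pushSymBody : Tm (3 + suc k)
  pushSymBody = apps (appsFin (# 2) k (λ i → var (3 ↑ʳ i))) (#ᵛ 1 ∷ #ᵛ 0 ∷ [])

  -- pushSym = λb.λx.λκ. b P_k ⋯ P_0 x κ  with P = pushTable
  pushSymᵛ : Val 0
  pushSymᵛ = closure pushTable (ƛ ƛ pushSymBody)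

  pushSym-steps : ∀ a x κ → Steps (3 + (suc k + 2)) (apps (val pushSymᵛ) (symᵛ (just a) ∷ encStr x ∷ κ ∷ []))
                                                   (app (val κ) (encStr (a ∷ x)))
  pushSym-steps a x κ =
    Steps-≡ refl (cong (λ u → apps u (encStr x ∷ κ ∷ [])) (subT-appsFin _ (# 2) k _))
            (β-closure₃ pushTable pushSymBody (symᵛ (just a)) (encStr x) κ []) ++ₛ
    Steps-apps (encStr x ∷ κ ∷ []) (select-appsFin k (suc a) pushTable) ++ₛ
    push-steps a x κ

  emitBody : Tm 9
  emitBody = apps (# 7) (#ᵛ 3 ∷ #ᵛ 0 ∷ #ᵛ 4 ∷ [])

  -- revAppend (a ∷ ps) = λx. pushSym ⌜a⌝ x (revAppend ps); the padding makes it literally the closure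
  -- that tapeToString builds
  mutual
    revAppendᵛ : List (Fin k) → Val 0
    revAppendᵛ []       = lam (# 0)
    revAppendᵛ (a ∷ ps) = closure (revAppendEnv a ps) emitBody

    revAppendEnv : Fin k → List (Fin k) → Env 8
    revAppendEnv a ps =
      nilᵛ ∷ₑ nilᵛ ∷ₑ symᵛ (just a) ∷ₑ revAppendᵛ ps ∷ₑ
      nilᵛ ∷ₑ nilᵛ ∷ₑ pushSymᵛ ∷ₑ encStr {k} [] ∷ₑ ∅ₑ

  revAppend-steps : ∀ ps x → Steps (length ps * (k + 7) + 1) (app (val (revAppendᵛ ps)) (encStr x))
                                                             (val (encStr (ps ʳ++ x)))
  revAppend-steps []       x = step₁ (β-closure ∅ₑ (# 0) (encStr x))
  revAppend-steps (a ∷ ps) x = Steps-count (cost k (length ps))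
    (β-closure₁ (revAppendEnv a ps) emitBody (encStr x) [] ++ₛ
     pushSym-steps a x (revAppendᵛ ps) ++ₛ
     revAppend-steps ps (a ∷ x))
    where
      cost : ∀ k P → 1 + (3 + (suc k + 2) + (P * (k + 7) + 1)) ≡ suc P * (k + 7) + 1
      cost = solve-∀

  onConsBody : Tm 8
  onConsBody = apps (# 5) (#ᵛ 5 ∷ #ᵛ 1 ∷ lam emitBody ∷ [])

  onNil onCons : Val 5
  onNil  = lam (app (# 1) (#ᵛ 5))
  onCons = lam (ƛ ƛ onConsBody)

  tapeToStringBody : Tm 5
  tapeToStringBody = apps (# 1) (onNil ∷ onCons ∷ #ᵛ 0 ∷ [])

  -- tapeToString = λc.λR.λκ. R (λ_. κ ⌜[]⌝) (λb.λl.λ_. c c l (λx. pushSym b x κ)), always applied to itself as c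
  tapeToStringᵛ : Val 0
  tapeToStringᵛ = closure (pushSymᵛ ∷ₑ encStr {k} [] ∷ₑ ∅ₑ) (ƛ ƛ tapeToStringBody)

  tapeToStringEnv : Val 0 → Val 0 → Env 5
  tapeToStringEnv R κ = κ ∷ₑ R ∷ₑ tapeToStringᵛ ∷ₑ pushSymᵛ ∷ₑ encStr {k} [] ∷ₑ ∅ₑ

  tapeToString-start : ∀ R κ →
    Steps 3 (apps (val tapeToStringᵛ) (tapeToStringᵛ ∷ R ∷ κ ∷ []))
            (apps (val R) (subV (tapeToStringEnv R κ) onNil ∷ subV (tapeToStringEnv R κ) onCons ∷ κ ∷ []))
  tapeToString-start R κ =
    β-closure₃ (pushSymᵛ ∷ₑ encStr {k} [] ∷ₑ ∅ₑ) tapeToStringBody tapeToStringᵛ R κ []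

  tapeToString-steps : ∀ xs ps →
    Steps (length xs * 8 + (length xs + length ps) * (k + 7) + 7)
          (apps (val tapeToStringᵛ) (tapeToStringᵛ ∷ tapeᵛ (map just xs) ∷ revAppendᵛ ps ∷ []))
          (val (encStr ((xs ʳ++ ps) ʳ++ [])))
  tapeToString-steps [] ps = Steps-count (cost k (length ps))
    (tapeToString-start nilᵛ κ ++ₛ
     nilᵛ-case (subV E onNil) (subV E onCons) κ ++ₛ
     β-closure₁ E (app (# 1) (#ᵛ 5)) κ [] ++ₛ
     revAppend-steps ps [])
    where
      κ : Val 0
      κ = revAppendᵛ ps
      E : Env 5
      E = tapeToStringEnv nilᵛ κ
      cost : ∀ k P → 3 + (2 + (1 + (P * (k + 7) + 1))) ≡ 0 * 8 + (0 + P) * (k + 7) + 7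
      cost = solve-∀
  tapeToString-steps (x ∷ xs) ps = Steps-count (cost k (length xs) (length ps))
    (tapeToString-start R κ ++ₛ
     consᵛ-case (symᵛ (just x)) tl (subV E onNil) (subV E onCons) κ ++ₛ
     β-closure₃ E onConsBody (symᵛ (just x)) tl κ [] ++ₛ
     tapeToString-steps xs (x ∷ ps))
    where
      κ tl R : Val 0
      κ  = revAppendᵛ ps
      tl = tapeᵛ (map just xs)
      R  = tapeᵛ (map just (x ∷ xs))
      E : Env 5
      E = tapeToStringEnv R κ
      cost : ∀ k X P → 3 + (2 + (3 + (X * 8 + (X + suc P) * (k + 7) + 7))) ≡ suc X * 8 + (suc X + P) * (k + 7) + 7
      cost = solve-∀

  haltBody : Tm 5
  haltBody = apps (# 4) (#ᵛ 4 ∷ #ᵛ 0 ∷ lam (# 0) ∷ [])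

  -- halt = λT.λL.λa.λR. tapeToString tapeToString R (λx. x)
  haltᵛ : Val 0
  haltᵛ = closure (tapeToStringᵛ ∷ₑ ∅ₑ) (ƛ ƛ ƛ haltBody)

  halt-steps : ∀ T L a fs →
    Steps (4 + (length fs * 8 + (length fs + 0) * (k + 7) + 7))
          (apps (val haltᵛ) (T ∷ L ∷ a ∷ tapeᵛ (map just fs) ∷ [])) (val (encStr fs))
  halt-steps T L a fs =
    Steps-≡ refl (cong (λ x → val (encStr x)) (reverse-involutive fs))
      (β-closure₄ (tapeToStringᵛ ∷ₑ ∅ₑ) haltBody T L a (tapeᵛ (map just fs)) [] ++ₛ tapeToString-steps fs [])

  -- the variables of a move body: 0 = R, 1 = L, 2 = T, 3 = ⌜q′⌝, 4 = ⌜b⌝, 5 = ⌜□⌝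
  rightNilBody leftNilBody : Tm 7
  rightNilBody = apps (# 3) (#ᵛ 4 ∷ #ᵛ 3 ∷ lam (ƛ apps (# 0) (#ᵛ 7 ∷ #ᵛ 4 ∷ [])) ∷ #ᵛ 6 ∷ nilᵛ ∷ [])
  leftNilBody  = apps (# 3) (#ᵛ 4 ∷ #ᵛ 3 ∷ nilᵛ ∷ #ᵛ 6 ∷ lam (ƛ apps (# 0) (#ᵛ 7 ∷ #ᵛ 3 ∷ [])) ∷ [])

  rightConsBody leftConsBody : Tm 9
  rightConsBody = apps (# 5) (#ᵛ 6 ∷ #ᵛ 5 ∷ lam (ƛ apps (# 0) (#ᵛ 9 ∷ #ᵛ 6 ∷ [])) ∷ #ᵛ 2 ∷ #ᵛ 1 ∷ [])
  leftConsBody  = apps (# 5) (#ᵛ 6 ∷ #ᵛ 5 ∷ #ᵛ 1 ∷ #ᵛ 2 ∷ lam (ƛ apps (# 0) (#ᵛ 9 ∷ #ᵛ 5 ∷ [])) ∷ [])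

  moveBody : Dir → Tm 6
  moveBody stay  = apps (# 2) (#ᵛ 3 ∷ #ᵛ 2 ∷ #ᵛ 1 ∷ #ᵛ 4 ∷ #ᵛ 0 ∷ [])
  moveBody right = apps (# 0) (lam rightNilBody ∷ lam (ƛ ƛ rightConsBody) ∷ #ᵛ 0 ∷ [])
  moveBody left  = apps (# 1) (lam leftNilBody ∷ lam (ƛ ƛ leftConsBody) ∷ #ᵛ 0 ∷ [])

  moveEnv : Fin states → Sym□ k → Env 3
  moveEnv q′ b = stateᵛ q′ ∷ₑ symᵛ b ∷ₑ symᵛ nothing ∷ₑ ∅ₑ

  -- move q′ b d = λT.λL.λR. T ⌜q′⌝ T ⌜l′⌝ ⌜a′⌝ ⌜r′⌝ for the tape (l′, a′, r′) after writing b and moving d;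
  -- e.g. move q′ b right = λT.λL.λR. R (λ_. T ⌜q′⌝ T (b ∷ L) □ []) (λc.λr.λ_. T ⌜q′⌝ T (b ∷ L) c r) R
  moveᵛ : Fin states → Sym□ k → Dir → Val 0
  moveᵛ q′ b d = closure (moveEnv q′ b) (ƛ ƛ moveBody d)

  actionᵛ : Maybe (Fin states × Sym□ k × Dir) → Val 0
  actionᵛ nothing            = nilᵛ
  actionᵛ (just (q′ , b , d)) = moveᵛ q′ b d

  actionTable : Fin states → Fin (suc k) → Val 0
  actionTable q i = actionᵛ (δ q (ixSym i))

  readSymBody : Tm (4 + suc k)
  readSymBody = apps (appsFin (# 1) k (λ i → var (4 ↑ʳ i))) (#ᵛ 3 ∷ #ᵛ 2 ∷ #ᵛ 0 ∷ [])

  -- readSym q = λT.λL.λa.λR. a A_k ⋯ A_0 T L R  with A = actionTable q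
  readSymᵛ : Fin states → Val 0
  readSymᵛ q = closure (actionTable q) (ƛ ƛ ƛ readSymBody)

  behaviourᵛ : (q : Fin states) → Dec (q ≡ q-fin) → Val 0
  behaviourᵛ q (yes _) = haltᵛ
  behaviourᵛ q (no _)  = readSymᵛ q

  stateTable : Fin (suc states) → Val 0
  stateTable zero    = nilᵛ
  stateTable (suc q) = behaviourᵛ q (q ≟ q-fin)

  dispatchBody : Tm (suc (suc states))
  dispatchBody = appsFin (# 0) states (λ i → var (1 ↑ʳ i))

  -- T = λq. q S_states ⋯ S_0  with S = stateTable
  dispatchᵛ : Val 0
  dispatchᵛ = closure stateTable dispatchBody

  configTm : Config k states → Tm 0
  configTm (conf l a r q) = apps (val dispatchᵛ) (stateᵛ q ∷ dispatchᵛ ∷ tapeᵛ l ∷ symᵛ a ∷ tapeᵛ r ∷ [])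

  dispatch-steps : ∀ l a r q →
    Steps (2 + states) (configTm (conf l a r q))
                       (apps (val (stateTable (suc q))) (dispatchᵛ ∷ tapeᵛ l ∷ symᵛ a ∷ tapeᵛ r ∷ []))
  dispatch-steps l a r q =
    Steps-≡ refl (cong (λ u → apps u args) (subT-appsFin _ (# 0) states _))
            (β-closure₁ stateTable dispatchBody (stateᵛ q) args) ++ₛ
    Steps-apps args (select-appsFin states (suc q) stateTable)
    where
      args : List (Val 0)
      args = dispatchᵛ ∷ tapeᵛ l ∷ symᵛ a ∷ tapeᵛ r ∷ []

  readSym-steps : ∀ q T L a R →
    Steps (4 + suc k) (apps (val (readSymᵛ q)) (T ∷ L ∷ symᵛ a ∷ R ∷ []))
                      (apps (val (actionTable q (symIx a))) (T ∷ L ∷ R ∷ []))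
  readSym-steps q T L a R =
    Steps-≡ refl (cong (λ u → apps u (T ∷ L ∷ R ∷ [])) (subT-appsFin _ (# 1) k _))
            (β-closure₄ (actionTable q) readSymBody T L (symᵛ a) R []) ++ₛ
    Steps-apps (T ∷ L ∷ R ∷ []) (select-appsFin k (symIx a) (actionTable q))

  move-start : ∀ q′ b d L R →
    Steps 3 (apps (val (moveᵛ q′ b d)) (dispatchᵛ ∷ L ∷ R ∷ []))
            (subT (R ∷ₑ L ∷ₑ dispatchᵛ ∷ₑ moveEnv q′ b) (moveBody d))
  move-start q′ b d L R = β-closure₃ (moveEnv q′ b) (moveBody d) dispatchᵛ L R []

  move-steps : ∀ q′ b d l r →
    StepsWithin 0 8 (apps (val (moveᵛ q′ b d)) (dispatchᵛ ∷ tapeᵛ l ∷ tapeᵛ r ∷ []))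
                    (configTm (move l b r q′ d))
  move-steps q′ b stay l r =
    StepsWithin-weaken z≤n (m≤m+n 3 5) (exactly (move-start q′ b stay (tapeᵛ l) (tapeᵛ r)))
  move-steps q′ b right l [] = StepsWithin-weaken z≤n (m≤m+n 6 2) (exactly
    (move-start q′ b right L nilᵛ ++ₛ
     nilᵛ-case (subV E (lam rightNilBody)) (subV E (lam (ƛ ƛ rightConsBody))) nilᵛ ++ₛ
     β-closure₁ E rightNilBody nilᵛ []))
    where
      L : Val 0
      L = tapeᵛ l
      E : Env 6
      E = nilᵛ ∷ₑ L ∷ₑ dispatchᵛ ∷ₑ moveEnv q′ b
  move-steps q′ b right l (c ∷ r) = StepsWithin-weaken z≤n ≤-refl (exactly
    (move-start q′ b right L R ++ₛ
     consᵛ-case (symᵛ c) (tapeᵛ r) (subV E (lam rightNilBody)) (subV E (lam (ƛ ƛ rightConsBody))) R ++ₛ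
     β-closure₃ E rightConsBody (symᵛ c) (tapeᵛ r) R []))
    where
      L R : Val 0
      L = tapeᵛ l
      R = tapeᵛ (c ∷ r)
      E : Env 6
      E = R ∷ₑ L ∷ₑ dispatchᵛ ∷ₑ moveEnv q′ b
  move-steps q′ b left [] r = StepsWithin-weaken z≤n (m≤m+n 6 2) (exactly
    (move-start q′ b left nilᵛ R ++ₛ
     nilᵛ-case (subV E (lam leftNilBody)) (subV E (lam (ƛ ƛ leftConsBody))) R ++ₛ
     β-closure₁ E leftNilBody R []))
    where
      R : Val 0
      R = tapeᵛ r
      E : Env 6
      E = R ∷ₑ nilᵛ ∷ₑ dispatchᵛ ∷ₑ moveEnv q′ b
  move-steps q′ b left (c ∷ l) r = StepsWithin-weaken z≤n ≤-refl (exactly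
    (move-start q′ b left L R ++ₛ
     consᵛ-case (symᵛ c) (tapeᵛ l) (subV E (lam leftNilBody)) (subV E (lam (ƛ ƛ leftConsBody))) R ++ₛ
     β-closure₃ E leftConsBody (symᵛ c) (tapeᵛ l) R []))
    where
      L R : Val 0
      L = tapeᵛ (c ∷ l)
      R = tapeᵛ r
      E : Env 6
      E = R ∷ₑ L ∷ₑ dispatchᵛ ∷ₑ moveEnv q′ b

  stateTable-live : ∀ q → q ≢ q-fin → stateTable (suc q) ≡ readSymᵛ q
  stateTable-live q q≢q-fin with q ≟ q-fin
  ... | yes q≡q-fin = contradiction q≡q-fin q≢q-fin
  ... | no _        = refl

  stateTable-fin : stateTable (suc q-fin) ≡ haltᵛ
  stateTable-fin with q-fin ≟ q-fin
  ... | yes _  = refl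
  ... | no q≢q = contradiction refl q≢q

  actionTable-symIx : ∀ q a → actionTable q (symIx a) ≡ actionᵛ (δ q a)
  actionTable-symIx q nothing  = refl
  actionTable-symIx q (just a) = refl

  stepCost : ℕ
  stepCost = 15 + (k + states)

  step-steps : ∀ c c′ → stepTM M c ≡ just c′ → StepsWithin 1 stepCost (configTm c) (configTm c′)
  step-steps (conf l a r q) c′ eq with δ q a in δqa
  ... | just (q′ , b , d) with refl ← eq =
    StepsWithin-weaken (s≤s z≤n) (≤-reflexive (cost k states))
      (exactly (dispatch-steps l a r q ++ₛ
                Steps-≡ (cong (λ v → apps (val v) (dispatchᵛ ∷ L ∷ symᵛ a ∷ R ∷ [])) (sym behaviour))
                        (cong (λ v → apps (val v) (dispatchᵛ ∷ L ∷ R ∷ [])) action)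
                        (readSym-steps q dispatchᵛ L a R))
       ++ʷ move-steps q′ b d l r)
    where
      L R : Val 0
      L = tapeᵛ l
      R = tapeᵛ r
      live : q ≢ q-fin
      live q≡q-fin with () ← trans (sym δqa) (trans (cong (λ p → δ p a) q≡q-fin) (δ-fin a))
      behaviour : stateTable (suc q) ≡ readSymᵛ q
      behaviour = stateTable-live q live
      action : actionTable q (symIx a) ≡ moveᵛ q′ b d
      action = trans (actionTable-symIx q a) (cong actionᵛ δqa)
      cost : ∀ k Q → 2 + Q + (4 + suc k) + 8 ≡ 15 + (k + Q)
      cost = solve-∀

  consKBody : Tm 5
  consKBody = app (# 1) (lam (ƛ apps (# 0) (#ᵛ 6 ∷ #ᵛ 2 ∷ [])))

  readLetterBody : Tm 4
  readLetterBody = apps (# 1) (#ᵛ 1 ∷ #ᵛ 2 ∷ lam consKBody ∷ [])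

  -- readLetter a = λs.λc.λκ. c c s (λt. κ (⌜a⌝ ∷ t))
  readLetterᵛ : Fin k → Val 0
  readLetterᵛ a = closure (symᵛ (just a) ∷ₑ ∅ₑ) (ƛ ƛ readLetterBody)

  readEndᵛ : Val 0
  readEndᵛ = closure ∅ₑ (ƛ app (# 0) nilᵛ)

  -- ⌜a ∷ s⌝ selects its argument of de Bruijn index suc (opposite a)
  readTable : Fin (suc k) → Val 0
  readTable zero    = readEndᵛ
  readTable (suc i) = readLetterᵛ (opposite i)

  readInputBody : Tm (3 + suc k)
  readInputBody = apps (appsFin (# 1) k (λ i → var (3 ↑ʳ i))) (#ᵛ 2 ∷ #ᵛ 0 ∷ [])

  -- readInput = λc.λs.λκ. s I_k ⋯ I_0 c κ  with I = readTable, always applied to itself as c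
  readInputᵛ : Val 0
  readInputᵛ = closure readTable (ƛ ƛ readInputBody)

  initialEnv : Env 3
  initialEnv = dispatchᵛ ∷ₑ stateᵛ q-in ∷ₑ symᵛ nothing ∷ₑ ∅ₑ

  initialKBody : Tm 4
  initialKBody = apps (# 1) (#ᵛ 2 ∷ #ᵛ 1 ∷ nilᵛ ∷ #ᵛ 3 ∷ #ᵛ 0 ∷ [])

  -- initialK [] = λt. T ⌜q-in⌝ T [] □ t  and  initialK (a ∷ ps) = λt. initialK ps (a ∷ t); the padding makes
  -- the latter literally the closure that readLetter builds
  mutual
    initialKᵛ : List (Sym□ k) → Val 0
    initialKᵛ []       = closure initialEnv initialKBody
    initialKᵛ (a ∷ ps) = closure (initialKEnv a ps) consKBody

    initialKEnv : Sym□ k → List (Sym□ k) → Env 4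
    initialKEnv a ps = initialKᵛ ps ∷ₑ nilᵛ ∷ₑ nilᵛ ∷ₑ symᵛ a ∷ₑ ∅ₑ

  initialK-steps : ∀ ps tl →
    Steps (suc (length ps)) (app (val (initialKᵛ ps)) (tapeᵛ tl)) (configTm (conf [] nothing (ps ʳ++ tl) q-in))
  initialK-steps []       tl = β-closure₁ initialEnv initialKBody (tapeᵛ tl) []
  initialK-steps (a ∷ ps) tl =
    β-closure₁ (initialKEnv a ps) consKBody (tapeᵛ tl) [] ++ₛ initialK-steps ps (a ∷ tl)

  readInput-start : ∀ s κ →
    Steps 3 (apps (val readInputᵛ) (readInputᵛ ∷ s ∷ κ ∷ []))
            (apps (appsFin (val s) k readTable) (readInputᵛ ∷ κ ∷ []))
  readInput-start s κ =
    Steps-≡ refl (cong (λ u → apps u (readInputᵛ ∷ κ ∷ [])) (subT-appsFin _ (# 1) k _))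
            (β-closure₃ readTable readInputBody readInputᵛ s κ [])

  readInput-steps : ∀ s ps →
    Steps (length s * (k + 8) + (k + 7 + length ps))
          (apps (val readInputᵛ) (readInputᵛ ∷ encStr s ∷ initialKᵛ ps ∷ []))
          (configTm (conf [] nothing ((map just s ʳ++ ps) ʳ++ []) q-in))
  readInput-steps [] ps = Steps-count (cost k (length ps))
    (readInput-start (encStr {k} []) κ ++ₛ
     Steps-apps (readInputᵛ ∷ κ ∷ []) (encStr-[]-appsFin readTable) ++ₛ
     β-closure₂ ∅ₑ (app (# 0) nilᵛ) readInputᵛ κ [] ++ₛ
     initialK-steps ps [])
    where
      κ : Val 0
      κ = initialKᵛ ps
      cost : ∀ k P → 3 + (suc k + (2 + suc P)) ≡ 0 * (k + 8) + (k + 7 + P)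
      cost = solve-∀
  readInput-steps (a ∷ s) ps = Steps-count (cost k (length s) (length ps))
    (readInput-start (encStr (a ∷ s)) κ ++ₛ
     Steps-≡ refl (cong (λ b → apps (val (readLetterᵛ b)) (encStr s ∷ readInputᵛ ∷ κ ∷ []))
                        (opposite-involutive a))
             (Steps-apps (readInputᵛ ∷ κ ∷ []) (encStr-∷-appsFin a s readTable)) ++ₛ
     β-closure₃ (symᵛ (just a) ∷ₑ ∅ₑ) readLetterBody (encStr s) readInputᵛ κ [] ++ₛ
     readInput-steps s (just a ∷ ps))
    where
      κ : Val 0
      κ = initialKᵛ ps
      cost : ∀ k S P → 3 + (suc k + (3 + (S * (k + 8) + (k + 7 + suc P)))) ≡ suc S * (k + 8) + (k + 7 + P)
      cost = solve-∀

  machineEnv : Env 2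
  machineEnv = readInputᵛ ∷ₑ initialKᵛ [] ∷ₑ ∅ₑ

  machineBody : Tm 3
  machineBody = apps (# 1) (#ᵛ 1 ∷ #ᵛ 0 ∷ #ᵛ 2 ∷ [])

  -- ⌜M⌝ = λs. readInput readInput s (initialK [])
  machineᵛ : Val 0
  machineᵛ = closure machineEnv machineBody

  input-phase : ∀ s → StepsWithin (length s) (length s * stepCost + stepCost)
                        (app (val machineᵛ) (encStr s)) (configTm (conf [] nothing (map just s) q-in))
  input-phase s =
    StepsWithin-weaken lower upper (exactly
      (Steps-≡ refl (cong (λ tape → configTm (conf [] nothing tape q-in)) (reverse-involutive (map just s)))
        (Steps-count (cost k (length s))
          (β-closure₁ machineEnv machineBody (encStr s) [] ++ₛ
           readInput-steps s []))))
    where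
      cost : ∀ k S → 1 + (S * (k + 8) + (k + 7 + 0)) ≡ S * (8 + k) + (8 + k)
      cost = solve-∀
      8+k≤stepCost : 8 + k ≤ stepCost
      8+k≤stepCost = +-mono-≤ (m≤m+n 8 7) (m≤m+n k states)
      lower : length s ≤ length s * (8 + k) + (8 + k)
      lower = ≤-trans (m≤m*n (length s) (8 + k)) (m≤m+n _ _)
      upper : length s * (8 + k) + (8 + k) ≤ length s * stepCost + stepCost
      upper = +-mono-≤ (*-monoʳ-≤ (length s) 8+k≤stepCost) 8+k≤stepCost

  run-steps : ∀ t c c′ → runTM M t c ≡ just c′ → StepsWithin t (t * stepCost) (configTm c) (configTm c′)
  run-steps zero    c .c refl = exactly done
  run-steps (suc t) c c′ eq with runTM-suc M t c c′ eq
  ... | c₁ , stepped , ran = step-steps c c₁ stepped ++ʷ run-steps t c₁ c′ ran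

  output-phase : ∀ fs → StepsWithin 0 (length fs * stepCost + stepCost)
                          (configTm (conf [] nothing (map just fs) q-fin)) (val (encStr fs))
  output-phase fs =
    StepsWithin-weaken z≤n upper (exactly (Steps-count (cost k states (length fs))
      (dispatch-steps [] nothing (map just fs) q-fin ++ₛ
       Steps-≡ (cong (λ v → apps (val v) (dispatchᵛ ∷ nilᵛ ∷ symᵛ nothing ∷ R ∷ [])) (sym stateTable-fin)) refl
               (halt-steps dispatchᵛ nilᵛ (symᵛ nothing) fs))))
    where
      R : Val 0
      R = tapeᵛ (map just fs)
      cost : ∀ k Q F → 2 + Q + (4 + (F * 8 + (F + 0) * (k + 7) + 7)) ≡ F * (15 + k) + (13 + Q)
      cost = solve-∀
      upper : length fs * (15 + k) + (13 + states) ≤ length fs * stepCost + stepCost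
      upper = +-mono-≤ (*-monoʳ-≤ (length fs) (+-monoʳ-≤ 15 (m≤m+n k states)))
                       (+-mono-≤ (m≤m+n 13 2) (m≤n+m states k))

theorem1 : ∀ {k : ℕ} (M : TM k) (f : List (Fin k) → List (Fin k)) (g : ℕ → ℕ) →
           Computes M f g →
           Σ (Tm 0) λ codeM → Σ ℕ λ c → ∀ (s : List (Fin k)) →
             Σ ℕ λ n → Steps n (app codeM (encStr s)) (val (encStr (f s)))
               × n ≤ c * (g (length s) + length s) + c
               × g (length s) + length s ≤ c * n
theorem1 M f g computes = val machineᵛ , 2 * stepCost , simulate
  where
    open Simulation M
    simulate : ∀ s → Σ ℕ λ n → Steps n (app (val machineᵛ) (encStr s)) (val (encStr (f s)))
                       × n ≤ 2 * stepCost * (g (length s) + length s) + 2 * stepCost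
                       × g (length s) + length s ≤ 2 * stepCost * n
    simulate s =
      let n , steps , lower , upper = input-phase s ++ʷ run-steps (g (length s)) _ _ (computes s) ++ʷ output-phase (f s)
      in  n , steps , linear-sandwich stepCost {length s} {g (length s)} (s≤s z≤n) output≤ lower upper
      where
        output≤ : length (f s) ≤ length s + g (length s)
        output≤ = subst₂ (λ a b → a ≤ b + g (length s)) (length-map just (f s)) (length-map just s)
                         (runTM-tapeLength M (g (length s)) _ _ (computes s))
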